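{- Let $G$ be a complete signed graph, let $u\neq v$ with $\{u,v\}$ of sign $-$ in $G$, and let $H$ be obtained from $G$ by flipping the sign of $\{u,v\}$ to $+$. Let $w\in N_{G^+}(u)$ and $T=|N_{G^+}(u)\,\Delta\,N_{G^+}(w)|$. \begin{enumerate} \item If $u$ and $w$ are in $\varepsilon$-agreement in $G^+$, then they are in $\varepsilon$-agreement in $H^+$ if any of the following holds: (a) $w\in N_{G^+}(u)\cap N_{G^+}(v)$; (b) $w\in N_{G^+}(u)\setminus N_{G^+}(v)$, $w\neq v$, $|N_{G^+}(u)|\geq|N_{G^+}(w)|$, and $T\geq|N_{G^+}(u)|$. \item If $u$ and $w$ are not in $\varepsilon$-agreement in $G^+$, then they are not in $\varepsilon$-agreement in $H^+$ if any of the following holds: (a) $w\in N_{G^+}(u)\setminus N_{G^+}(v)$, $w\neq v$, and $|N_{G^+}(u)|<|N_{G^+}(w)|$; (b) $w\in N_{G^+}(u)\setminus N_{G^+}(v)$, $w\neq v$, $|N_{G^+}(u)|\geq|N_{G^+}(w)|$, and $T<|N_{G^+}(u)|$. \end{enumerate}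
   Context: A complete signed graph on a finite vertex set $V$ assigns to every unordered pair of distinct vertices a sign $+$ or $-$. For such a graph $X$, its positive graph $X^+$ has vertex set $V$ and as edges the pairs of sign $+$; $N_{X^+}(a)$ is the open neighborhood of $a$ in $X^+$. Fix $\varepsilon>0$. $\mathrm{NonAgreement}_{X^+}(a,b)=\frac{|N_{X^+}(a)\,\Delta\,N_{X^+}(b)|}{\max\{|N_{X^+}(a)|,|N_{X^+}(b)|\}}$ ($\Delta$ = symmetric difference). Vertices $a,b$ are in $\varepsilon$-agreement in $X^+$ if $\{a,b\}$ is an edge of $X^+$ and $\mathrm{NonAgreement}_{X^+}(a,b)<\varepsilon$.
   Formalization: The parameter ε ranges over the positive rationals instead of the positive reals. -}

module Defs where

open import Data.Nat using (ℕ; zero; suc; _⊔_)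
open import Data.Integer using (+_)
open import Data.Rational using (ℚ; 0ℚ; _/_; _<_)
open import Data.Bool using (Bool; true; false; _∧_; _∨_; not; if_then_else_)
open import Data.Bool.Properties using (∧-comm; ∨-comm)
open import Data.Fin using (Fin; _≟_)
open import Data.Fin.Subset using (Subset; _∈_; _─_; _∪_; ∣_∣)
open import Data.Vec using (tabulate)
open import Data.Product using (_×_)
open import Relation.Nullary.Decidable using (⌊_⌋)
open import Relation.Binary.PropositionalEquality using (_≡_; cong₂; trans)

data Sign : Set where
  pos neg : Sign

isPos : Sign → Bool
isPos pos = true
isPos neg = false

-- A complete signed graph on the vertex set Fin n: every unordered pair
-- {a,b} (a ≠ b) gets a sign; values on the diagonal are irrelevant.
record SignedGraph (n : ℕ) : Set where
  field
    sign    : Fin n → Fin n → Sign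
    sign-sym : ∀ a b → sign a b ≡ sign b a
open SignedGraph public

isPair : ∀ {n} → Fin n → Fin n → Fin n → Fin n → Bool
isPair u v a b = (⌊ a ≟ u ⌋ ∧ ⌊ b ≟ v ⌋) ∨ (⌊ a ≟ v ⌋ ∧ ⌊ b ≟ u ⌋)

isPair-sym : ∀ {n} (u v a b : Fin n) → isPair u v a b ≡ isPair u v b a
isPair-sym u v a b =
  trans (cong₂ _∨_ (∧-comm ⌊ a ≟ u ⌋ ⌊ b ≟ v ⌋) (∧-comm ⌊ a ≟ v ⌋ ⌊ b ≟ u ⌋))
        (∨-comm (⌊ b ≟ v ⌋ ∧ ⌊ a ≟ u ⌋) (⌊ b ≟ u ⌋ ∧ ⌊ a ≟ v ⌋))

flipToPos : ∀ {n} → SignedGraph n → Fin n → Fin n → SignedGraph n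
flipToPos G u v = record
  { sign = λ a b → if isPair u v a b then pos else sign G a b
  ; sign-sym = λ a b → helper a b
  }
  where
  helper : ∀ a b → (if isPair u v a b then pos else sign G a b)
                 ≡ (if isPair u v b a then pos else sign G b a)
  helper a b = cong₂ (λ c s → if c then pos else s) (isPair-sym u v a b) (sign-sym G a b)

posAdj : ∀ {n} → SignedGraph n → Fin n → Fin n → Bool
posAdj G a b = not ⌊ a ≟ b ⌋ ∧ isPos (sign G a b)

N⁺ : ∀ {n} → SignedGraph n → Fin n → Subset n
N⁺ G a = tabulate (λ b → posAdj G a b)

_Δ_ : ∀ {n} → Subset n → Subset n → Subset n
p Δ q = (p ─ q) ∪ (q ─ p)

-- x / d as a rational; the case d = 0 (undefined in the paper) is set to 0,
-- it never arises for adjacent vertices.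
ratio : ℕ → ℕ → ℚ
ratio x zero = 0ℚ
ratio x (suc d) = (+ x) / suc d

NonAgreement : ∀ {n} → SignedGraph n → Fin n → Fin n → ℚ
NonAgreement G a b =
  ratio ∣ N⁺ G a Δ N⁺ G b ∣ (∣ N⁺ G a ∣ ⊔ ∣ N⁺ G b ∣)

InAgreement : ∀ {n} → ℚ → SignedGraph n → Fin n → Fin n → Set
InAgreement ε G a b = (b ∈ N⁺ G a) × (NonAgreement G a b < ε)

{-# OPTIONS --safe #-}
module Submission where

-- Flipping {u,v} to + adds v to N⁺(u) and leaves N⁺(w) unchanged for every w ∉ {u,v}.
-- Hence |N⁺(u)| grows by one, and N⁺(u) Δ N⁺(w) changes exactly at v: it loses v when
-- v ∈ N⁺(w) and gains it otherwise. Every case then compares T/max(m,k) with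
-- (T ∓ 1)/max(m+1,k), where m = |N⁺(u)| and k = |N⁺(w)|; the delicate comparison,
-- (T+1)/(m+1) against T/m, goes one way or the other according as T ≥ m or T ≤ m.

open import Defs

open import Data.Bool using (true; false; _xor_)
open import Data.Bool.Properties using (∨-identityʳ; ∧-zeroʳ; not-¬; ¬-not)
open import Data.Empty using (⊥-elim)
open import Data.Fin using (Fin; zero; suc; _≟_)
open import Data.Fin.Properties using (suc-injective)
open import Data.Fin.Subset using (Subset; _∈_; _∉_; ∣_∣)
open import Data.Fin.Subset.Properties using (x∈p⇒∣p-x∣<∣p∣)
open import Data.Integer as ℤ using (+_; +≤+)
open import Data.Integer.Properties using (pos-*)
open import Data.Nat using (ℕ; suc; pred; _⊔_; _*_; _≥_; z≤n; s≤s)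
  renaming (_≤_ to _≤ℕ_; _<_ to _<ℕ_)
open import Data.Nat.Properties
  using (≤-trans; ≤-refl; <⇒≤; n≤1+n; m≤n⇒m≤1+n; pred[n]≤n; *-suc; *-mono-≤; +-monoˡ-≤;
         m≤m⊔n; ⊔-monoˡ-≤; m≥n⇒m⊔n≡m; m≤n⇒m⊔n≡n; <-≤-connex)
open import Data.Product using (_×_; _,_)
open import Data.Rational using (ℚ; 0ℚ; _<_; _≤_)
open import Data.Rational.Properties using (module ≤-Reasoning; toℚᵘ-cancel-≤; toℚᵘ-fromℚᵘ)
import Data.Rational.Unnormalised as ℚᵘ
import Data.Rational.Unnormalised.Properties as ℚᵘ
open import Data.Sum using (_⊎_; inj₁; inj₂)
open import Data.Vec using (_∷_; lookup)
open import Data.Vec.Relation.Binary.Pointwise.Extensional using (ext; Pointwise-≡⇒≡)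
open import Data.Vec.Properties using (lookup∘tabulate; tabulate-cong; []=⇒lookup; lookup⇒[]=)
open import Function using (_∘_; id)
open import Relation.Nullary using (¬_; yes; no)
open import Relation.Nullary.Decidable using (⌊_⌋)
open import Relation.Binary.PropositionalEquality

ratio-≤ : ∀ a c d d' → 1 ≤ℕ d → 1 ≤ℕ d' → a * d' ≤ℕ c * d → ratio a d ≤ ratio c d'
ratio-≤ a c (suc b) (suc b') _ _ ad'≤cd =
  toℚᵘ-cancel-≤ (ℚᵘ.≤-respʳ-≃ (ℚᵘ.≃-sym (toℚᵘ-fromℚᵘ (ℚᵘ.mkℚᵘ (+ c) b')))
                 (ℚᵘ.≤-respˡ-≃ (ℚᵘ.≃-sym (toℚᵘ-fromℚᵘ (ℚᵘ.mkℚᵘ (+ a) b))) (ℚᵘ.*≤* ad'≤cdᶻ)))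
  where
  ad'≤cdᶻ : + a ℤ.* + suc b' ℤ.≤ + c ℤ.* + suc b
  ad'≤cdᶻ rewrite sym (pos-* a (suc b')) | sym (pos-* c (suc b)) = +≤+ ad'≤cd

ratio-mono-≤ : ∀ {a c d d'} → a ≤ℕ c → d' ≤ℕ d → 1 ≤ℕ d' → ratio a d ≤ ratio c d'
ratio-mono-≤ {a} {c} {d} {d'} a≤c d'≤d 1≤d' =
  ratio-≤ a c d d' (≤-trans 1≤d' d'≤d) 1≤d' (*-mono-≤ a≤c d'≤d)

ratio-suc-suc-≤ : ∀ {a d} → 1 ≤ℕ d → d ≤ℕ a → ratio (suc a) (suc d) ≤ ratio a d
ratio-suc-suc-≤ {a} {d} 1≤d d≤a =
  ratio-≤ (suc a) a (suc d) d (s≤s z≤n) 1≤d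
    (subst (suc a * d ≤ℕ_) (sym (*-suc a d)) (+-monoˡ-≤ (a * d) d≤a))

ratio-≤-suc-suc : ∀ {a d} → 1 ≤ℕ d → a ≤ℕ d → ratio a d ≤ ratio (suc a) (suc d)
ratio-≤-suc-suc {a} {d} 1≤d a≤d =
  ratio-≤ a (suc a) d (suc d) 1≤d (s≤s z≤n)
    (subst (_≤ℕ suc a * d) (sym (*-suc a d)) (+-monoˡ-≤ (a * d) a≤d))

ratio-⊔-pred-suc-≤ : ∀ t m k → 1 ≤ℕ m → ratio (pred t) (suc m ⊔ k) ≤ ratio t (m ⊔ k)
ratio-⊔-pred-suc-≤ t m k 1≤m =
  ratio-mono-≤ pred[n]≤n (⊔-monoˡ-≤ k (n≤1+n m)) (≤-trans 1≤m (m≤m⊔n m k))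

ratio-⊔-suc-suc-≤ : ∀ t m k → k ≤ℕ m → m ≤ℕ t → 1 ≤ℕ m →
                    ratio (suc t) (suc m ⊔ k) ≤ ratio t (m ⊔ k)
ratio-⊔-suc-suc-≤ t m k k≤m m≤t 1≤m
  rewrite m≥n⇒m⊔n≡m k≤m | m≥n⇒m⊔n≡m (m≤n⇒m≤1+n k≤m) = ratio-suc-suc-≤ 1≤m m≤t

ratio-⊔-≤-suc-suc : ∀ t m k → 1 ≤ℕ m → m <ℕ k ⊎ t ≤ℕ m →
                    ratio t (m ⊔ k) ≤ ratio (suc t) (suc m ⊔ k)
ratio-⊔-≤-suc-suc t m k _ (inj₁ m<k) = ratio-≤-suc-⊔-absorbed m<k
  where
  ratio-≤-suc-⊔-absorbed : m <ℕ k → ratio t (m ⊔ k) ≤ ratio (suc t) (suc m ⊔ k)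
  ratio-≤-suc-⊔-absorbed m<k rewrite m≤n⇒m⊔n≡n (<⇒≤ m<k) | m≤n⇒m⊔n≡n m<k =
    ratio-mono-≤ (n≤1+n t) ≤-refl (≤-trans (s≤s z≤n) m<k)
ratio-⊔-≤-suc-suc t m k 1≤m (inj₂ t≤m) with <-≤-connex m k
... | inj₁ m<k = ratio-⊔-≤-suc-suc t m k 1≤m (inj₁ m<k)
... | inj₂ k≤m rewrite m≥n⇒m⊔n≡m k≤m | m≥n⇒m⊔n≡m (m≤n⇒m≤1+n k≤m) = ratio-≤-suc-suc 1≤m t≤m

AgreeExcept : ∀ {n} → Fin n → Subset n → Subset n → Set
AgreeExcept x p q = ∀ y → y ≢ x → lookup p y ≡ lookup q y

lookup-Δ : ∀ {n} (p q : Subset n) i → lookup (p Δ q) i ≡ lookup p i xor lookup q i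
lookup-Δ (true  ∷ p) (true  ∷ q) zero    = refl
lookup-Δ (true  ∷ p) (false ∷ q) zero    = refl
lookup-Δ (false ∷ p) (true  ∷ q) zero    = refl
lookup-Δ (false ∷ p) (false ∷ q) zero    = refl
lookup-Δ (_     ∷ p) (_     ∷ q) (suc i) = lookup-Δ p q i

Δ-agreeExcept : ∀ {n x} (p p' q : Subset n) →
                AgreeExcept x p p' → AgreeExcept x (p Δ q) (p' Δ q)
Δ-agreeExcept p p' q agree y y≢x = begin
  lookup (p Δ q) y              ≡⟨ lookup-Δ p q y ⟩
  lookup p y xor lookup q y     ≡⟨ cong (_xor lookup q y) (agree y y≢x) ⟩
  lookup p' y xor lookup q y    ≡⟨ sym (lookup-Δ p' q y) ⟩
  lookup (p' Δ q) y             ∎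
  where open ≡-Reasoning

∣∣-insert : ∀ {n} (p q : Subset n) x → AgreeExcept x p q →
            lookup p x ≡ false → lookup q x ≡ true → ∣ q ∣ ≡ suc ∣ p ∣
∣∣-insert (_ ∷ p) (_ ∷ q) zero agree refl refl =
  cong (suc ∘ ∣_∣) (Pointwise-≡⇒≡ {xs = q} {p} (ext λ y → sym (agree (suc y) λ ())))
∣∣-insert (b ∷ p) (c ∷ q) (suc x) agree px qx =
  ∣∷∣-suc b c (agree zero λ ())
    (∣∣-insert p q x (λ y y≢x → agree (suc y) (y≢x ∘ suc-injective)) px qx)
  where
  ∣∷∣-suc : ∀ b c → b ≡ c → ∣ q ∣ ≡ suc ∣ p ∣ → ∣ c ∷ q ∣ ≡ suc ∣ b ∷ p ∣
  ∣∷∣-suc true  .true  refl = cong suc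
  ∣∷∣-suc false .false refl = id

module _ {n} (p p' q : Subset n) {x} (agree : AgreeExcept x p p')
         (px : lookup p x ≡ false) (p'x : lookup p' x ≡ true) where

  ∣Δ∣-insert-∈ : lookup q x ≡ true → ∣ p Δ q ∣ ≡ suc ∣ p' Δ q ∣
  ∣Δ∣-insert-∈ qx = ∣∣-insert (p' Δ q) (p Δ q) x (λ y y≢x → sym (Δ-agreeExcept p p' q agree y y≢x))
    (trans (lookup-Δ p' q x) (cong₂ _xor_ p'x qx))
    (trans (lookup-Δ p q x) (cong₂ _xor_ px qx))

  ∣Δ∣-insert-∉ : lookup q x ≡ false → ∣ p' Δ q ∣ ≡ suc ∣ p Δ q ∣
  ∣Δ∣-insert-∉ qx = ∣∣-insert (p Δ q) (p' Δ q) x (Δ-agreeExcept p p' q agree)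
    (trans (lookup-Δ p q x) (cong₂ _xor_ px qx))
    (trans (lookup-Δ p' q x) (cong₂ _xor_ p'x qx))

lookup-N⁺ : ∀ {n} (G : SignedGraph n) a b → lookup (N⁺ G a) b ≡ posAdj G a b
lookup-N⁺ G a = lookup∘tabulate (posAdj G a)

posAdj-irrefl : ∀ {n} (G : SignedGraph n) a → posAdj G a a ≡ false
posAdj-irrefl G a with a ≟ a
... | yes _   = refl
... | no a≢a = ⊥-elim (a≢a refl)

posAdj-sym : ∀ {n} (G : SignedGraph n) a b → posAdj G a b ≡ posAdj G b a
posAdj-sym G a b rewrite sign-sym G a b with a ≟ b | b ≟ a
... | yes _   | yes _   = refl
... | no _    | no _    = refl
... | yes a≡b | no b≢a = ⊥-elim (b≢a (sym a≡b))
... | no a≢b  | yes b≡a = ⊥-elim (a≢b (sym b≡a))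

posAdj-neg : ∀ {n} (G : SignedGraph n) a b → sign G a b ≡ neg → posAdj G a b ≡ false
posAdj-neg G a b ab⁻ rewrite ab⁻ = ∧-zeroʳ _

lookup-N⁺-sym : ∀ {n} (G : SignedGraph n) a b → lookup (N⁺ G a) b ≡ lookup (N⁺ G b) a
lookup-N⁺-sym G a b = begin
  lookup (N⁺ G a) b  ≡⟨ lookup-N⁺ G a b ⟩
  posAdj G a b       ≡⟨ posAdj-sym G a b ⟩
  posAdj G b a       ≡⟨ sym (lookup-N⁺ G b a) ⟩
  lookup (N⁺ G b) a  ∎
  where open ≡-Reasoning

∈N⁺⇒≢ : ∀ {n} (G : SignedGraph n) {a b} → b ∈ N⁺ G a → b ≢ a
∈N⁺⇒≢ G {a} b∈ refl = not-¬ ([]=⇒lookup b∈) (trans (lookup-N⁺ G a a) (posAdj-irrefl G a))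

isPair-u : ∀ {n} {u v : Fin n} b → u ≢ v → isPair u v u b ≡ ⌊ b ≟ v ⌋
isPair-u {u = u} {v} b u≢v with u ≟ u | u ≟ v
... | no u≢u | _       = ⊥-elim (u≢u refl)
... | yes _  | yes u≡v = ⊥-elim (u≢v u≡v)
... | yes _  | no _    = ∨-identityʳ _

posAdj-flip-uv : ∀ {n} (G : SignedGraph n) {u v} → u ≢ v → posAdj (flipToPos G u v) u v ≡ true
posAdj-flip-uv G {u} {v} u≢v rewrite isPair-u v u≢v with v ≟ v | u ≟ v
... | no v≢v | _       = ⊥-elim (v≢v refl)
... | yes _  | yes u≡v = ⊥-elim (u≢v u≡v)
... | yes _  | no _    = refl

posAdj-flip-u : ∀ {n} (G : SignedGraph n) {u v} b → u ≢ v → b ≢ v →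
                posAdj (flipToPos G u v) u b ≡ posAdj G u b
posAdj-flip-u G {u} {v} b u≢v b≢v rewrite isPair-u b u≢v with b ≟ v
... | yes b≡v = ⊥-elim (b≢v b≡v)
... | no _    = refl

posAdj-flip-other : ∀ {n} (G : SignedGraph n) {u v w} b → w ≢ u → w ≢ v →
                    posAdj (flipToPos G u v) w b ≡ posAdj G w b
posAdj-flip-other G {u} {v} {w} b w≢u w≢v with w ≟ u | w ≟ v
... | yes w≡u | _       = ⊥-elim (w≢u w≡u)
... | no _    | yes w≡v = ⊥-elim (w≢v w≡v)
... | no _    | no _    = refl

module _ {n} (G : SignedGraph n) {u v : Fin n} (u≢v : u ≢ v) (uv⁻ : sign G u v ≡ neg) where

  private
    H : SignedGraph n
    H = flipToPos G u v

  v∉N⁺u : lookup (N⁺ G u) v ≡ false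
  v∉N⁺u = trans (lookup-N⁺ G u v) (posAdj-neg G u v uv⁻)

  v∈N⁺u-flip : lookup (N⁺ H u) v ≡ true
  v∈N⁺u-flip = trans (lookup-N⁺ H u v) (posAdj-flip-uv G u≢v)

  N⁺u-flip-agreeExcept : AgreeExcept v (N⁺ G u) (N⁺ H u)
  N⁺u-flip-agreeExcept b b≢v = begin
    lookup (N⁺ G u) b  ≡⟨ lookup-N⁺ G u b ⟩
    posAdj G u b       ≡⟨ sym (posAdj-flip-u G b u≢v b≢v) ⟩
    posAdj H u b       ≡⟨ sym (lookup-N⁺ H u b) ⟩
    lookup (N⁺ H u) b  ∎
    where open ≡-Reasoning

  ∈N⁺u⇒≢v : ∀ {w} → w ∈ N⁺ G u → w ≢ v
  ∈N⁺u⇒≢v w∈ refl = not-¬ ([]=⇒lookup w∈) v∉N⁺u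

  ∈N⁺u-flip : ∀ {w} → w ∈ N⁺ G u → w ∈ N⁺ H u
  ∈N⁺u-flip {w} w∈ = lookup⇒[]= w (N⁺ H u)
    (trans (sym (N⁺u-flip-agreeExcept w (∈N⁺u⇒≢v w∈))) ([]=⇒lookup w∈))

  ∣N⁺u-flip∣ : ∣ N⁺ H u ∣ ≡ suc ∣ N⁺ G u ∣
  ∣N⁺u-flip∣ = ∣∣-insert (N⁺ G u) (N⁺ H u) v N⁺u-flip-agreeExcept v∉N⁺u v∈N⁺u-flip

  module _ {w} (w∈ : w ∈ N⁺ G u) where

    private
      m k T : ℕ
      m = ∣ N⁺ G u ∣
      k = ∣ N⁺ G w ∣
      T = ∣ N⁺ G u Δ N⁺ G w ∣

    NonAgreement-flip : NonAgreement H u w ≡ ratio ∣ N⁺ H u Δ N⁺ G w ∣ (suc m ⊔ k)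
    NonAgreement-flip = cong₂ (λ q d → ratio ∣ N⁺ H u Δ q ∣ (d ⊔ ∣ q ∣)) N⁺w-flip ∣N⁺u-flip∣
      where
      N⁺w-flip : N⁺ H w ≡ N⁺ G w
      N⁺w-flip = tabulate-cong (λ b → posAdj-flip-other G b (∈N⁺⇒≢ G w∈) (∈N⁺u⇒≢v w∈))

    NonAgreement-flip-∈ : w ∈ N⁺ G v → NonAgreement H u w ≡ ratio (pred T) (suc m ⊔ k)
    NonAgreement-flip-∈ w∈v = trans NonAgreement-flip (cong (λ t → ratio (pred t) (suc m ⊔ k))
      (sym (∣Δ∣-insert-∈ (N⁺ G u) (N⁺ H u) (N⁺ G w) N⁺u-flip-agreeExcept v∉N⁺u v∈N⁺u-flip v∈N⁺w)))
      where
      v∈N⁺w : lookup (N⁺ G w) v ≡ true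
      v∈N⁺w = trans (lookup-N⁺-sym G w v) ([]=⇒lookup w∈v)

    NonAgreement-flip-∉ : w ∉ N⁺ G v → NonAgreement H u w ≡ ratio (suc T) (suc m ⊔ k)
    NonAgreement-flip-∉ w∉v = trans NonAgreement-flip (cong (λ t → ratio t (suc m ⊔ k))
      (∣Δ∣-insert-∉ (N⁺ G u) (N⁺ H u) (N⁺ G w) N⁺u-flip-agreeExcept v∉N⁺u v∈N⁺u-flip v∉N⁺w))
      where
      v∉N⁺w : lookup (N⁺ G w) v ≡ false
      v∉N⁺w = trans (lookup-N⁺-sym G w v) (¬-not (w∉v ∘ lookup⇒[]= w (N⁺ G v)))

    private
      1≤m : 1 ≤ℕ m
      1≤m = ≤-trans (s≤s z≤n) (x∈p⇒∣p-x∣<∣p∣ w∈)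

    module _ (ε : ℚ) where
      open ≤-Reasoning

      InAgreement-flip-∈ : w ∈ N⁺ G v → InAgreement ε G u w → InAgreement ε H u w
      InAgreement-flip-∈ w∈v (_ , NA<ε) = ∈N⁺u-flip w∈ , (begin-strict
        NonAgreement H u w          ≡⟨ NonAgreement-flip-∈ w∈v ⟩
        ratio (pred T) (suc m ⊔ k)  ≤⟨ ratio-⊔-pred-suc-≤ T m k 1≤m ⟩
        NonAgreement G u w          <⟨ NA<ε ⟩
        ε                           ∎)

      InAgreement-flip-∉ : w ∉ N⁺ G v → k ≤ℕ m → m ≤ℕ T → InAgreement ε G u w → InAgreement ε H u w
      InAgreement-flip-∉ w∉v k≤m m≤T (_ , NA<ε) = ∈N⁺u-flip w∈ , (begin-strict
        NonAgreement H u w          ≡⟨ NonAgreement-flip-∉ w∉v ⟩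
        ratio (suc T) (suc m ⊔ k)   ≤⟨ ratio-⊔-suc-suc-≤ T m k k≤m m≤T 1≤m ⟩
        NonAgreement G u w          <⟨ NA<ε ⟩
        ε                           ∎)

      ¬InAgreement-flip-∉ : w ∉ N⁺ G v → m <ℕ k ⊎ T ≤ℕ m →
                            ¬ InAgreement ε G u w → ¬ InAgreement ε H u w
      ¬InAgreement-flip-∉ w∉v m<k⊎T≤m ¬agree (_ , NA'<ε) = ¬agree (w∈ , (begin-strict
        NonAgreement G u w          ≤⟨ ratio-⊔-≤-suc-suc T m k 1≤m m<k⊎T≤m ⟩
        ratio (suc T) (suc m ⊔ k)   ≡⟨ sym (NonAgreement-flip-∉ w∉v) ⟩
        NonAgreement H u w          <⟨ NA'<ε ⟩
        ε                           ∎))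

proposition1 : ∀ {n : ℕ} (ε : ℚ) → 0ℚ < ε →
    (G : SignedGraph n) (u v : Fin n) → u ≢ v → sign G u v ≡ neg →
    (w : Fin n) → w ∈ N⁺ G u →
    let H = flipToPos G u v
        T = ∣ N⁺ G u Δ N⁺ G w ∣
    in (InAgreement ε G u w →
          ((w ∈ N⁺ G u × w ∈ N⁺ G v)
           ⊎ (w ∈ N⁺ G u × w ∉ N⁺ G v × w ≢ v × ∣ N⁺ G u ∣ ≥ ∣ N⁺ G w ∣ × T ≥ ∣ N⁺ G u ∣)) →
          InAgreement ε H u w)
     × (¬ InAgreement ε G u w →
          ((w ∈ N⁺ G u × w ∉ N⁺ G v × w ≢ v × ∣ N⁺ G u ∣ <ℕ ∣ N⁺ G w ∣)
           ⊎ (w ∈ N⁺ G u × w ∉ N⁺ G v × w ≢ v × ∣ N⁺ G u ∣ ≥ ∣ N⁺ G w ∣ × T <ℕ ∣ N⁺ G u ∣)) →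
          ¬ InAgreement ε H u w)
proposition1 ε _ G u v u≢v uv⁻ w w∈ =
    (λ { agree (inj₁ (_ , w∈v)) →
           InAgreement-flip-∈ G u≢v uv⁻ w∈ ε w∈v agree
       ; agree (inj₂ (_ , w∉v , _ , k≤m , m≤T)) →
           InAgreement-flip-∉ G u≢v uv⁻ w∈ ε w∉v k≤m m≤T agree })
  , (λ { ¬agree (inj₁ (_ , w∉v , _ , m<k)) →
           ¬InAgreement-flip-∉ G u≢v uv⁻ w∈ ε w∉v (inj₁ m<k) ¬agree
       ; ¬agree (inj₂ (_ , w∉v , _ , _ , T<m)) →
           ¬InAgreement-flip-∉ G u≢v uv⁻ w∈ ε w∉v (inj₂ (<⇒≤ T<m)) ¬agree })
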